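{- For every well-typed $\mathsf{t}$-closed $\mathsf{e}$-term $u_*$ of the $\mathsf{ptq}$-calculus, the quantity $\ell(u_*)$ (the supremum of the lengths of the control reductions starting from $u_*$) is finite. Moreover, $\ell(u_*)=\mathcal{M}_{o}(u_*)\,\mathsf{id}-1$, where $o$ is the map that associates $0$ to every free $\mathsf{p}$-variable of $u_*$ and $\mathsf{id}:\mathbb{N}\to\mathbb{N}$ is the identity.
   Context: The $\mathsf{ptq}$-calculus has $\mathsf{p}$-variables $x$, $\mathsf{t}$-variables $k$, a constant $*$, and terms: $\mathsf{p}$-terms $p ::= x \mid \lambda\langle x,k\rangle.u \mid \lambda k.u$; $\mathsf{t}$-terms $t ::= * \mid k \mid \langle p,t\rangle \mid \lambda x.u$; $\mathsf{q}$-terms $q ::= \overline{\lambda} k.u$; $\mathsf{e}$-terms $u ::= t;p \mid q\,t$ (terms are taken up to $\alpha$-conversion and are well-typed in the paper's simple type system, in which each $\mathsf{t}$-term/$\mathsf{e}$-term contains exactly one free occurrence of a $\mathsf{t}$-variable, always named $k$, or one occurrence of $*$). A term is $\mathsf{t}$-closed if it has no free $\mathsf{t}$-variable; for a $\mathsf{t}$-closed $\mathsf{t}$-term $t_*$ or $\mathsf{e}$-term $u_*$, $t$ and $u$ denote the terms with $t_*=t[*/k]$, $u_*=u[*/k]$. The reduction rules (on $\mathsf{t}$-closed terms) are: $*;\lambda k.u \to u_*$; $\langle p,t_*\rangle;\lambda k.u \to u[\langle p,t_*\rangle/k]$; $\langle p,t_*\rangle;\lambda\langle x,k\rangle.u \to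 u[p/x,t_*/k]$; $\lambda x.u_*;p \to u_*[p/x]$; $(\overline{\lambda} k.u)\,t_* \to u[t_*/k]$. The third rule is the $\beta$-rule; all the others are control rules, and a control reduction is a reduction sequence that contracts no $\beta$-redex. Define $\ell(u_*)=\sup\{l \mid l$ is the length of a control reduction $u_*\to^* u_*'\}$. Given $\sigma$ from $\mathsf{p}$-variables to $\mathbb{N}$, the measure $\mathcal{M}_\sigma$ maps $\mathsf{t}$-closed $\mathsf{t}$-terms to functions $(\mathbb{N}\to\mathbb{N})\to\mathbb{N}\to\mathbb{N}$, $\mathsf{p}$-terms to $\mathbb{N}$, and $\mathsf{q}$-terms and $\mathsf{t}$-closed $\mathsf{e}$-terms to functions $(\mathbb{N}\to\mathbb{N})\to\mathbb{N}$, by: $\mathcal{M}_\sigma(*)\,f\,n=f\,n$; $\mathcal{M}_\sigma(\langle p,t_*\rangle)\,f\,n=n$; $\mathcal{M}_\sigma(\lambda x.u_*)\,f\,n=\mathcal{M}_{\sigma[x\mapsto n]}(u_*)\,f$; $\mathcal{M}_\sigma(x)=\sigma(x)$; $\mathcal{M}_\sigma(\lambda\langle x,k\rangle.u)=0$; $\mathcal{M}_\sigma(\lambda k.u)=\mathcal{M}_\sigma(u_*)\,\mathsf{id}$; $\mathcal{M}_\sigma(\overline{\lambda} k.u)\,f=\mathcal{M}_\sigma(u_*)\,f$; $\mathcal{M}_\sigma(t_*;p)\,f=\mathcal{M}_\sigma(t_*)\,f\,\mathcal{M}_\sigma(p)+1$; $\mathcal{M}_\sigma(q\,t_*)\,f=\mathcal{M}_\sigma(q)\,(\mathcal{M}_\sigma(t_*)\,f)+1$.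 -}

module Defs where

open import Data.Nat using (ℕ; zero; suc; _+_; _≤_)
open import Data.Fin using (Fin; zero; suc)
open import Data.Product using (Σ; ∃; _×_)
open import Function using (id)

-- p-variables are de Bruijn indices (terms up to α-conversion); the
-- index n is the number of p-variables in scope.
--
-- The t-variable is always named k and every t-term / e-term contains
-- exactly one free occurrence of k or exactly one occurrence of *.
-- This is enforced intrinsically by the Mode index:
--   hole : the term contains exactly one free k (and no *)
--   star : the term contains exactly one *  (i.e. it is t-closed)
-- Since there is a single t-variable name k, an occurrence of k is
-- bound by the nearest enclosing t-binder (λk, λ⟨x,k⟩, λ̄k).

data Mode : Set where
  hole star : Mode

mutual
  -- p-terms  p ::= x | λ⟨x,k⟩.u | λk.u
  data P (n : ℕ) : Set where
    var     : Fin n → P n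
    lamPair : E (suc n) hole → P n
    lamK    : E n hole → P n

  -- t-terms  t ::= * | k | ⟨p,t⟩ | λx.u
  data T (n : ℕ) : Mode → Set where
    ⋆    : T n star
    kvar : T n hole
    pair : ∀ {m} → P n → T n m → T n m
    lamX : ∀ {m} → E (suc n) m → T n m

  -- q-terms  q ::= λ̄k.u
  data Q (n : ℕ) : Set where
    lamBar : E n hole → Q n

  -- e-terms  u ::= t;p | q t
  data E (n : ℕ) : Mode → Set where
    cut : ∀ {m} → T n m → P n → E n m
    app : ∀ {m} → Q n → T n m → E n m

Ren : ℕ → ℕ → Set
Ren n n' = Fin n → Fin n'

liftR : ∀ {n n'} → Ren n n' → Ren (suc n) (suc n')
liftR ρ zero    = zero
liftR ρ (suc i) = suc (ρ i)

mutual
  renP : ∀ {n n'} → Ren n n' → P n → P n'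
  renP ρ (var x)     = var (ρ x)
  renP ρ (lamPair u) = lamPair (renE (liftR ρ) u)
  renP ρ (lamK u)    = lamK (renE ρ u)

  renT : ∀ {n n' m} → Ren n n' → T n m → T n' m
  renT ρ ⋆          = ⋆
  renT ρ kvar       = kvar
  renT ρ (pair p t) = pair (renP ρ p) (renT ρ t)
  renT ρ (lamX u)   = lamX (renE (liftR ρ) u)

  renQ : ∀ {n n'} → Ren n n' → Q n → Q n'
  renQ ρ (lamBar u) = lamBar (renE ρ u)

  renE : ∀ {n n' m} → Ren n n' → E n m → E n' m
  renE ρ (cut t p) = cut (renT ρ t) (renP ρ p)
  renE ρ (app q t) = app (renQ ρ q) (renT ρ t)

Sub : ℕ → ℕ → Set
Sub n n' = Fin n → P n'

liftS : ∀ {n n'} → Sub n n' → Sub (suc n) (suc n')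
liftS s zero    = var zero
liftS s (suc i) = renP suc (s i)

mutual
  subP : ∀ {n n'} → Sub n n' → P n → P n'
  subP s (var x)     = s x
  subP s (lamPair u) = lamPair (subE (liftS s) u)
  subP s (lamK u)    = lamK (subE s u)

  subT : ∀ {n n' m} → Sub n n' → T n m → T n' m
  subT s ⋆          = ⋆
  subT s kvar       = kvar
  subT s (pair p t) = pair (subP s p) (subT s t)
  subT s (lamX u)   = lamX (subE (liftS s) u)

  subQ : ∀ {n n'} → Sub n n' → Q n → Q n'
  subQ s (lamBar u) = lamBar (subE s u)

  subE : ∀ {n n' m} → Sub n n' → E n m → E n' m
  subE s (cut t p) = cut (subT s t) (subP s p)
  subE s (app q t) = app (subQ s q) (subT s t)

_/x : ∀ {n} → P n → Sub (suc n) n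
(p /x) zero    = p
(p /x) (suc i) = var i

_[_/x] : ∀ {n m} → E (suc n) m → P n → E n m
u [ p /x] = subE (p /x) u

mutual
  plugT : ∀ {n m} → T n hole → T n m → T n m
  plugT kvar       s = s
  plugT (pair p t) s = pair p (plugT t s)
  plugT (lamX u)   s = lamX (plugE u (renT suc s))

  plugE : ∀ {n m} → E n hole → T n m → E n m
  plugE (cut t p) s = cut (plugT t s) p
  plugE (app q t) s = app q (plugT t s)

_[_/k] : ∀ {n m} → E n hole → T n m → E n m
u [ t /k] = plugE u t

_* : ∀ {n} → E n hole → E n star
u * = u [ ⋆ /k]

-- Control reduction rules (on t-closed e-terms; the β-rule
-- ⟨p,t_*⟩;λ⟨x,k⟩.u → u[p/x,t_*/k] is deliberately not included).

data _⟶c_ {n : ℕ} : E n star → E n star → Set where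
  *-λk   : ∀ (u : E n hole) →
           cut ⋆ (lamK u) ⟶c (u *)
  pair-λk : ∀ (p : P n) (t : T n star) (u : E n hole) →
           cut (pair p t) (lamK u) ⟶c (u [ pair p t /k])
  λx-p   : ∀ (u : E (suc n) star) (p : P n) →
           cut (lamX u) p ⟶c (u [ p /x])
  λ̄k-t   : ∀ (u : E n hole) (t : T n star) →
           app (lamBar u) t ⟶c (u [ t /k])

data ControlRed {n : ℕ} : E n star → E n star → ℕ → Set where
  done : ∀ {u} → ControlRed u u 0
  step : ∀ {u v w l} → u ⟶c v → ControlRed v w l → ControlRed u w (suc l)

ControlLengths : ∀ {n} → E n star → ℕ → Set
ControlLengths u l = ∃ λ u' → ControlRed u u' l

IsSup : (ℕ → Set) → ℕ → Set
IsSup S L = (∀ l → S l → l ≤ L) × (∀ b → (∀ l → S l → l ≤ b) → L ≤ b)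

-- The paper defines M_σ on t-closed terms t_*, u_* and sets
-- M_σ(λk.u) = M_σ(u_*) id.  To keep the definition structurally
-- recursive we define it on terms of either mode, with the clause
-- for k identical to the clause for *; hence for a hole-mode u the
-- value M_σ(u) is exactly M_σ(u_*) (u_* = u[*/k] only replaces that
-- single leaf).  On t-closed terms this is literally the paper's M_σ.

Env : ℕ → Set
Env n = Fin n → ℕ

_▹_ : ∀ {n} → Env n → ℕ → Env (suc n)
(σ ▹ a) zero    = a
(σ ▹ a) (suc i) = σ i

mutual
  MT : ∀ {n m} → Env n → T n m → (ℕ → ℕ) → ℕ → ℕ
  MT σ ⋆          f a = f a
  MT σ kvar       f a = f a
  MT σ (pair p t) f a = a
  MT σ (lamX u)   f a = ME (σ ▹ a) u f

  MP : ∀ {n} → Env n → P n → ℕ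
  MP σ (var x)     = σ x
  MP σ (lamPair u) = 0
  MP σ (lamK u)    = ME σ u id

  MQ : ∀ {n} → Env n → Q n → (ℕ → ℕ) → ℕ
  MQ σ (lamBar u) f = ME σ u f

  ME : ∀ {n m} → Env n → E n m → (ℕ → ℕ) → ℕ
  ME σ (cut t p) f = MT σ t f (MP σ p) + 1
  ME σ (app q t) f = MQ σ q (MT σ t f) + 1

o : ∀ {n} → Env n
o _ = 0

-- A control step decreases M_o(u) id by exactly one: each control rule
-- is a substitution, and the measure of a substitution instance is the
-- measure of the term in the environment/continuation given by the
-- measures of the substituted terms.  Every e-term has measure at least
-- 1, and a t-closed e-term without control redex has measure exactly 1
-- under o.  Hence every control reduction from u has length at most
-- M_o(u) id - 1, and reducing until no control redex is left attains it.
module Submission where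

open import Defs
open import Data.Nat using (ℕ; _∸_; zero; suc; _+_; _≤_; z≤n; s≤s)
open import Data.Nat.Properties
  using (+-comm; m≤m+n; +-∸-assoc; suc-injective; module ≤-Reasoning)
open import Data.Fin using (zero; suc)
open import Data.Product using (_,_; ∃)
open import Data.Sum using (_⊎_; inj₁; inj₂)
open import Function using (id; _∘_)
open import Relation.Binary.PropositionalEquality

mutual
  MT-cong : ∀ {n m} (σ : Env n) (t : T n m) {f g : ℕ → ℕ} → f ≗ g → MT σ t f ≗ MT σ t g
  MT-cong σ ⋆          f≗g a = f≗g a
  MT-cong σ kvar       f≗g a = f≗g a
  MT-cong σ (pair p t) f≗g a = refl
  MT-cong σ (lamX u)   f≗g a = ME-cong (σ ▹ a) u f≗g

  MQ-cong : ∀ {n} (σ : Env n) (q : Q n) {f g : ℕ → ℕ} → f ≗ g → MQ σ q f ≡ MQ σ q g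
  MQ-cong σ (lamBar u) f≗g = ME-cong σ u f≗g

  ME-cong : ∀ {n m} (σ : Env n) (u : E n m) {f g : ℕ → ℕ} → f ≗ g → ME σ u f ≡ ME σ u g
  ME-cong σ (cut t p) f≗g = cong (_+ 1) (MT-cong σ t f≗g (MP σ p))
  ME-cong σ (app q t) f≗g = cong (_+ 1) (MQ-cong σ q (MT-cong σ t f≗g))

liftR-▹ : ∀ {n n'} {ρ : Ren n n'} {σ : Env n'} {τ : Env n} →
  σ ∘ ρ ≗ τ → ∀ a → (σ ▹ a) ∘ liftR ρ ≗ τ ▹ a
liftR-▹ σρ≗τ a zero    = refl
liftR-▹ σρ≗τ a (suc i) = σρ≗τ i

mutual
  MP-renP : ∀ {n n'} (ρ : Ren n n') {σ : Env n'} {τ : Env n} → σ ∘ ρ ≗ τ →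
    (p : P n) → MP σ (renP ρ p) ≡ MP τ p
  MP-renP ρ σρ≗τ (var x)     = σρ≗τ x
  MP-renP ρ σρ≗τ (lamPair u) = refl
  MP-renP ρ σρ≗τ (lamK u)    = ME-renE ρ σρ≗τ u (λ _ → refl)

  MT-renT : ∀ {n n' m} (ρ : Ren n n') {σ : Env n'} {τ : Env n} → σ ∘ ρ ≗ τ →
    (t : T n m) {f g : ℕ → ℕ} → f ≗ g → MT σ (renT ρ t) f ≗ MT τ t g
  MT-renT ρ σρ≗τ ⋆          f≗g a = f≗g a
  MT-renT ρ σρ≗τ kvar       f≗g a = f≗g a
  MT-renT ρ σρ≗τ (pair p t) f≗g a = refl
  MT-renT ρ σρ≗τ (lamX u)   f≗g a = ME-renE (liftR ρ) (liftR-▹ σρ≗τ a) u f≗g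

  MQ-renQ : ∀ {n n'} (ρ : Ren n n') {σ : Env n'} {τ : Env n} → σ ∘ ρ ≗ τ →
    (q : Q n) {f g : ℕ → ℕ} → f ≗ g → MQ σ (renQ ρ q) f ≡ MQ τ q g
  MQ-renQ ρ σρ≗τ (lamBar u) f≗g = ME-renE ρ σρ≗τ u f≗g

  ME-renE : ∀ {n n' m} (ρ : Ren n n') {σ : Env n'} {τ : Env n} → σ ∘ ρ ≗ τ →
    (u : E n m) {f g : ℕ → ℕ} → f ≗ g → ME σ (renE ρ u) f ≡ ME τ u g
  ME-renE ρ {σ} σρ≗τ (cut t p) f≗g = cong (_+ 1) (begin
    MT σ (renT ρ t) _ (MP σ (renP ρ p)) ≡⟨ cong (MT σ (renT ρ t) _) (MP-renP ρ σρ≗τ p) ⟩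
    MT σ (renT ρ t) _ (MP _ p)          ≡⟨ MT-renT ρ σρ≗τ t f≗g _ ⟩
    MT _ t _ (MP _ p)                   ∎)
    where open ≡-Reasoning
  ME-renE ρ σρ≗τ (app q t) f≗g = cong (_+ 1) (MQ-renQ ρ σρ≗τ q (MT-renT ρ σρ≗τ t f≗g))

MT-weaken : ∀ {n m} (σ : Env n) (a : ℕ) (t : T n m) (f : ℕ → ℕ) →
  MT (σ ▹ a) (renT suc t) f ≗ MT σ t f
MT-weaken σ a t f = MT-renT suc (λ _ → refl) t (λ _ → refl)

liftS-▹ : ∀ {n n'} {s : Sub n n'} {σ : Env n'} {τ : Env n} →
  MP σ ∘ s ≗ τ → ∀ a → MP (σ ▹ a) ∘ liftS s ≗ τ ▹ a
liftS-▹         σs≗τ a zero    = refl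
liftS-▹ {s = s} σs≗τ a (suc i) = trans (MP-renP suc (λ _ → refl) (s i)) (σs≗τ i)

mutual
  MP-subP : ∀ {n n'} (s : Sub n n') {σ : Env n'} {τ : Env n} → MP σ ∘ s ≗ τ →
    (p : P n) → MP σ (subP s p) ≡ MP τ p
  MP-subP s σs≗τ (var x)     = σs≗τ x
  MP-subP s σs≗τ (lamPair u) = refl
  MP-subP s σs≗τ (lamK u)    = ME-subE s σs≗τ u (λ _ → refl)

  MT-subT : ∀ {n n' m} (s : Sub n n') {σ : Env n'} {τ : Env n} → MP σ ∘ s ≗ τ →
    (t : T n m) {f g : ℕ → ℕ} → f ≗ g → MT σ (subT s t) f ≗ MT τ t g
  MT-subT s σs≗τ ⋆          f≗g a = f≗g a
  MT-subT s σs≗τ kvar       f≗g a = f≗g a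
  MT-subT s σs≗τ (pair p t) f≗g a = refl
  MT-subT s σs≗τ (lamX u)   f≗g a = ME-subE (liftS s) (liftS-▹ σs≗τ a) u f≗g

  MQ-subQ : ∀ {n n'} (s : Sub n n') {σ : Env n'} {τ : Env n} → MP σ ∘ s ≗ τ →
    (q : Q n) {f g : ℕ → ℕ} → f ≗ g → MQ σ (subQ s q) f ≡ MQ τ q g
  MQ-subQ s σs≗τ (lamBar u) f≗g = ME-subE s σs≗τ u f≗g

  ME-subE : ∀ {n n' m} (s : Sub n n') {σ : Env n'} {τ : Env n} → MP σ ∘ s ≗ τ →
    (u : E n m) {f g : ℕ → ℕ} → f ≗ g → ME σ (subE s u) f ≡ ME τ u g
  ME-subE s {σ} σs≗τ (cut t p) f≗g = cong (_+ 1) (begin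
    MT σ (subT s t) _ (MP σ (subP s p)) ≡⟨ cong (MT σ (subT s t) _) (MP-subP s σs≗τ p) ⟩
    MT σ (subT s t) _ (MP _ p)          ≡⟨ MT-subT s σs≗τ t f≗g _ ⟩
    MT _ t _ (MP _ p)                   ∎)
    where open ≡-Reasoning
  ME-subE s σs≗τ (app q t) f≗g = cong (_+ 1) (MQ-subQ s σs≗τ q (MT-subT s σs≗τ t f≗g))

ME-[/x] : ∀ {n m} (σ : Env n) (u : E (suc n) m) (p : P n) (f : ℕ → ℕ) →
  ME σ (u [ p /x]) f ≡ ME (σ ▹ MP σ p) u f
ME-[/x] σ u p f = ME-subE (p /x) σp/x≗σ▹ u (λ _ → refl)
  where
  σp/x≗σ▹ : MP σ ∘ (p /x) ≗ σ ▹ MP σ p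
  σp/x≗σ▹ zero    = refl
  σp/x≗σ▹ (suc i) = refl

mutual
  MT-plugT : ∀ {n m} (σ : Env n) (t : T n hole) (s : T n m) (f : ℕ → ℕ) →
    MT σ (plugT t s) f ≗ MT σ t (MT σ s f)
  MT-plugT σ kvar       s f a = refl
  MT-plugT σ (pair p t) s f a = refl
  MT-plugT σ (lamX u)   s f a = begin
    ME (σ ▹ a) (plugE u (renT suc s)) f      ≡⟨ ME-[/k] (σ ▹ a) u (renT suc s) f ⟩
    ME (σ ▹ a) u (MT (σ ▹ a) (renT suc s) f) ≡⟨ ME-cong (σ ▹ a) u (MT-weaken σ a s f) ⟩
    ME (σ ▹ a) u (MT σ s f)                  ∎
    where open ≡-Reasoning

  ME-[/k] : ∀ {n m} (σ : Env n) (u : E n hole) (s : T n m) (f : ℕ → ℕ) →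
    ME σ (u [ s /k]) f ≡ ME σ u (MT σ s f)
  ME-[/k] σ (cut t p) s f = cong (_+ 1) (MT-plugT σ t s f (MP σ p))
  ME-[/k] σ (app q t) s f = cong (_+ 1) (MQ-cong σ q (MT-plugT σ t s f))

⟶c-ME : ∀ {n} {u v : E n star} (σ : Env n) → u ⟶c v → ME σ u id ≡ ME σ v id + 1
⟶c-ME σ (*-λk u)        = cong (_+ 1) (sym (ME-[/k] σ u ⋆ id))
⟶c-ME σ (pair-λk p t u) = cong (_+ 1) (sym (ME-[/k] σ u (pair p t) id))
⟶c-ME σ (λx-p u p)      = cong (_+ 1) (sym (ME-[/x] σ u p id))
⟶c-ME σ (λ̄k-t u t)      = cong (_+ 1) (sym (ME-[/k] σ u t id))

ControlRed-ME : ∀ {n} {u w : E n star} {l} (σ : Env n) →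
  ControlRed u w l → ME σ u id ≡ l + ME σ w id
ControlRed-ME σ done = refl
ControlRed-ME {u = u} {w} {suc l} σ (step {v = v} u⟶v v⟶*w) = begin
  ME σ u id            ≡⟨ ⟶c-ME σ u⟶v ⟩
  ME σ v id + 1        ≡⟨ cong (_+ 1) (ControlRed-ME σ v⟶*w) ⟩
  l + ME σ w id + 1    ≡⟨ +-comm _ 1 ⟩
  suc (l + ME σ w id)  ∎
  where open ≡-Reasoning

ME-positive : ∀ {n m} (σ : Env n) (u : E n m) (f : ℕ → ℕ) → ∃ λ k → ME σ u f ≡ suc k
ME-positive σ (cut t p) f = _ , +-comm _ 1
ME-positive σ (app q t) f = _ , +-comm _ 1

-- A term without control redex is t;x, of measure o x + 1 = 1 (this is
-- where the choice of o matters), or t;λ⟨x,k⟩.u, of measure 0 + 1.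
ME-one-or-⟶c : ∀ {n} (u : E n star) → ME o u id ≡ 1 ⊎ ∃ (u ⟶c_)
ME-one-or-⟶c (cut ⋆          (var x))     = inj₁ refl
ME-one-or-⟶c (cut ⋆          (lamPair u)) = inj₁ refl
ME-one-or-⟶c (cut ⋆          (lamK u))    = inj₂ (_ , *-λk u)
ME-one-or-⟶c (cut (pair p t) (var x))     = inj₁ refl
ME-one-or-⟶c (cut (pair p t) (lamPair u)) = inj₁ refl
ME-one-or-⟶c (cut (pair p t) (lamK u))    = inj₂ (_ , pair-λk p t u)
ME-one-or-⟶c (cut (lamX u)   p)           = inj₂ (_ , λx-p u p)
ME-one-or-⟶c (app (lamBar u) t)           = inj₂ (_ , λ̄k-t u t)

ControlRed-length≤ : ∀ {n} {u w : E n star} {l} →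
  ControlRed u w l → l ≤ ME o u id ∸ 1
ControlRed-length≤ {u = u} {w} {l} u⟶*w with ME-positive o w id
... | j , w≡suc = begin
  l                  ≤⟨ m≤m+n l j ⟩
  l + j              ≡⟨ sym (+-∸-assoc l (s≤s z≤n)) ⟩
  l + suc j ∸ 1      ≡⟨ cong (λ x → l + x ∸ 1) (sym w≡suc) ⟩
  l + ME o w id ∸ 1  ≡⟨ cong (_∸ 1) (sym (ControlRed-ME o u⟶*w)) ⟩
  ME o u id ∸ 1      ∎
  where open ≤-Reasoning

ControlRed-of-length : ∀ {n} k (u : E n star) → ME o u id ≡ suc k → ControlLengths u k
ControlRed-of-length zero    u _     = u , done
ControlRed-of-length (suc k) u u≡2+k with ME-one-or-⟶c u
... | inj₁ u≡1 with () ← trans (sym u≡2+k) u≡1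
... | inj₂ (v , u⟶v) with ControlRed-of-length k v v≡1+k
  where
  v≡1+k : ME o v id ≡ suc k
  v≡1+k = suc-injective (trans (sym (trans (⟶c-ME o u⟶v) (+-comm _ 1))) u≡2+k)
...   | w , v⟶*w = w , step u⟶v v⟶*w

lemma4 : ∀ {n : ℕ} (u : E n star) →
    IsSup (ControlLengths u) (ME o u id ∸ 1)
lemma4 u = (λ l (_ , u⟶*w) → ControlRed-length≤ u⟶*w) , least
  where
  least : ∀ b → (∀ l → ControlLengths u l → l ≤ b) → ME o u id ∸ 1 ≤ b
  least b bound with ME-positive o u id
  ... | k , u≡1+k rewrite u≡1+k = bound k (ControlRed-of-length k u u≡1+k)
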